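{- Let $G(L,R,E)$ be any bipartite graph and let $\varepsilon < 1/2$ be a parameter. Let $\lambda \leq \varepsilon/4$, $\beta \geq 2\lambda^{ -1}$, and $\beta^- \geq (1-\lambda)\cdot\beta$. Then for any subgraph $H$ that is an $\mathrm{EDCS}(G,\beta,\beta^-)$, $\mu(G) \leq (3/2+\varepsilon)\cdot\mu(H)$.
   Context: For a graph $G$, $\mu(G)$ denotes the size of a maximum matching, and $\deg_H(v)$ the degree of $v$ in $H$. For a graph $G(V,E)$ and parameters $\beta \geq \beta^- \geq 0$, an edge-degree constrained subgraph $\mathrm{EDCS}(G,\beta,\beta^-)$ is a subgraph $H=(V,E_H)$ of $G$ such that (P1) for every edge $(u,v)\in E_H$, $\deg_H(u)+\deg_H(v)\leq\beta$, and (P2) for every edge $(u,v)\in E\setminus E_H$, $\deg_H(u)+\deg_H(v)\geq\beta^-$. -}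

module Defs where

open import Data.Nat using (ℕ; zero; suc)
open import Data.Bool using (Bool; true; false)
open import Data.Fin using (Fin)
open import Data.Maybe using (Maybe; just; nothing)
open import Data.Integer using (+_)
open import Data.Rational using (ℚ; _/_; _≤_; _+_)
open import Relation.Binary.PropositionalEquality using (_≡_)

-- A bipartite graph G(L,R,E) with L = Fin a, R = Fin b,
-- given by its (decidable) edge relation E ⊆ L × R.
BipGraph : ℕ → ℕ → Set
BipGraph a b = Fin a → Fin b → Bool

count : {n : ℕ} → (Fin n → Bool) → ℕ
count {zero}  f = 0
count {suc n} f with f Fin.zero
... | true  = suc (count (λ i → f (Fin.suc i)))
... | false = count (λ i → f (Fin.suc i))

Subgraph : {a b : ℕ} → BipGraph a b → BipGraph a b → Set
Subgraph {a} {b} H G = ∀ (l : Fin a) (r : Fin b) → H l r ≡ true → G l r ≡ true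

degL : {a b : ℕ} → BipGraph a b → Fin a → ℕ
degL H l = count (λ r → H l r)

degR : {a b : ℕ} → BipGraph a b → Fin b → ℕ
degR H r = count (λ l → H l r)

toℚ : ℕ → ℚ
toℚ n = + n / 1

record IsEDCS {a b : ℕ} (G H : BipGraph a b) (β β⁻ : ℚ) : Set where
  field
    sub : Subgraph H G
    P1  : ∀ l r → G l r ≡ true → H l r ≡ true → toℚ (degL H l) + toℚ (degR H r) ≤ β
    P2  : ∀ l r → G l r ≡ true → H l r ≡ false → β⁻ ≤ toℚ (degL H l) + toℚ (degR H r)

-- A matching of a bipartite graph: each left vertex is matched to at most
-- one right vertex (partial function L → R), along an edge, injectively.
isJust : {A : Set} → Maybe A → Bool
isJust (just _) = true
isJust nothing  = false

record IsMatching {a b : ℕ} (G : BipGraph a b) (M : Fin a → Maybe (Fin b)) : Set where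
  field
    edges : ∀ l r → M l ≡ just r → G l r ≡ true
    inj   : ∀ l l′ r → M l ≡ just r → M l′ ≡ just r → l ≡ l′

size : {a b : ℕ} → (Fin a → Maybe (Fin b)) → ℕ
size M = count (λ l → isJust (M l))

record IsMaximumMatching {a b : ℕ} (G : BipGraph a b) (M : Fin a → Maybe (Fin b)) : Set where
  field
    matching : IsMatching G M
    maximum  : ∀ N → IsMatching G N → size N Data.Nat.≤ size M

-- Let N be a maximum matching of H.  König's theorem, proved below by growing the sets of
-- vertices reachable by alternating paths from unmatched vertices, gives a vertex cover C of H
-- with |C| ≤ |N|.  The edges of a maximum matching M of G that avoid C form a matching U of size
-- s, and |M| ≤ |C| + s.  No edge of U lies in H, so by (P2) each has H-degree sum at least
-- β⁻ ≥ (1 - λ)β, while by (P1) every edge of H has degree sum at most β.  All H-edges at the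
-- endpoints of U end in C; double counting them with 4βx ≤ 4x² + β² bounds four times the total
-- H-degree of the endpoints of U by (2s + |C|)β, and that total is at least sβ⁻.  Hence
-- (2 - 4λ)s ≤ |C|, and |M| ≤ |C| + s ≤ (3/2 + ε)|C| ≤ (3/2 + ε)|N| as λ ≤ ε/4 and ε < 1/2.
module Submission where

open import Data.Bool using (Bool; true; false; not; _∧_; _∨_; if_then_else_)
open import Data.Empty using (⊥; ⊥-elim)
open import Data.Fin using (Fin; zero; suc)
open import Data.Maybe using (Maybe; just; nothing)
open import Data.Product using (∃; _,_; _×_; proj₁; proj₂)
open import Function using (case_of_)
open import Data.Sum using (_⊎_; inj₁; inj₂)
open import Relation.Nullary using (yes; no)
open import Relation.Binary.PropositionalEquality
open import Defs

module FiniteSums where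
  open import Data.Nat
  open import Data.Nat.Properties
  open import Algebra.Properties.Semiring.Sum +-*-semiring using (sum; sum-cong-≗; ∑-distrib-+; *-distribˡ-sum; *-distribʳ-sum)
  open import Data.Nat.Tactic.RingSolver using (solve-∀)
  import Data.Fin.Properties as Fin

  ⟦_⟧ : Bool → ℕ
  ⟦ true ⟧  = 1
  ⟦ false ⟧ = 0

  ⟦⟧≤1 : ∀ c → ⟦ c ⟧ ≤ 1
  ⟦⟧≤1 true  = ≤-refl
  ⟦⟧≤1 false = z≤n

  ⟦⟧-pos : ∀ {c} → 0 < ⟦ c ⟧ → c ≡ true
  ⟦⟧-pos {true} _ = refl

  count≡∑ : ∀ {n} (p : Fin n → Bool) → count p ≡ sum (λ i → ⟦ p i ⟧)
  count≡∑ {zero}  p = refl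
  count≡∑ {suc n} p with p zero
  ... | true  = cong suc (count≡∑ (λ i → p (suc i)))
  ... | false = count≡∑ (λ i → p (suc i))

  ∑-mono-≤ : ∀ {n} {f g : Fin n → ℕ} → (∀ i → f i ≤ g i) → sum f ≤ sum g
  ∑-mono-≤ {zero}  f≤g = z≤n
  ∑-mono-≤ {suc n} f≤g = +-mono-≤ (f≤g zero) (∑-mono-≤ (λ i → f≤g (suc i)))

  ≤-∑ : ∀ {n} (f : Fin n → ℕ) i → f i ≤ sum f
  ≤-∑ f zero    = m≤m+n _ _
  ≤-∑ f (suc i) = ≤-trans (≤-∑ (λ j → f (suc j)) i) (m≤n+m _ (f zero))

  ∑-pos : ∀ {n} (f : Fin n → ℕ) → 0 < sum f → ∃ λ i → 0 < f i
  ∑-pos {suc n} f 0<∑ with f zero in eq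
  ... | suc _ = zero , subst (0 <_) (sym eq) (s≤s z≤n)
  ... | zero  with ∑-pos (λ i → f (suc i)) 0<∑
  ...   | i , 0<fi = suc i , 0<fi

  ∑⟦⟧-pos : ∀ {n} (p : Fin n → Bool) → 0 < sum (λ i → ⟦ p i ⟧) → ∃ λ i → p i ≡ true
  ∑⟦⟧-pos p 0<∑ with ∑-pos _ 0<∑
  ... | i , 0<pi = i , ⟦⟧-pos 0<pi

  ∑-≡0 : ∀ {n} (f : Fin n → ℕ) → (∀ i → f i ≡ 0) → sum f ≡ 0
  ∑-≡0 {zero}  f f≡0 = refl
  ∑-≡0 {suc n} f f≡0 = cong₂ _+_ (f≡0 zero) (∑-≡0 (λ i → f (suc i)) (λ i → f≡0 (suc i)))

  ∑-≤1 : ∀ {n} (f : Fin n → ℕ) → (∀ i → f i ≤ 1) →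
         (∀ i j → 0 < f i → 0 < f j → i ≡ j) → sum f ≤ 1
  ∑-≤1 {zero}  f f≤1 unique = z≤n
  ∑-≤1 {suc n} f f≤1 unique with f zero in eq
  ... | zero  = ∑-≤1 (λ i → f (suc i)) (λ i → f≤1 (suc i))
                  (λ i j p q → Fin.suc-injective (unique (suc i) (suc j) p q))
  ... | suc k = begin
      suc k + sum (λ i → f (suc i)) ≡⟨ cong (suc k +_) (∑-≡0 _ rest≡0) ⟩
      suc k + 0                     ≡⟨ +-identityʳ _ ⟩
      suc k                         ≡⟨ sym eq ⟩
      f zero                        ≤⟨ f≤1 zero ⟩
      1                             ∎
    where
    open ≤-Reasoning
    rest≡0 : ∀ i → f (suc i) ≡ 0
    rest≡0 i with f (suc i) in eqᵢ
    ... | zero  = refl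
    ... | suc _ with unique (suc i) zero (subst (0 <_) (sym eqᵢ) (s≤s z≤n)) (subst (0 <_) (sym eq) (s≤s z≤n))
    ...   | ()

  ∑-*ˡ : ∀ {n} c (f : Fin n → ℕ) → sum (λ i → c * f i) ≡ c * sum f
  ∑-*ˡ c f = sym (*-distribˡ-sum c f)

  ∑-*ʳ : ∀ {n} c (f : Fin n → ℕ) → sum (λ i → f i * c) ≡ sum f * c
  ∑-*ʳ c f = sym (*-distribʳ-sum c f)

  ∑∑-distrib-+ : ∀ {m n} (f g : Fin m → Fin n → ℕ) →
                 sum (λ i → sum (λ j → f i j + g i j)) ≡ sum (λ i → sum (f i)) + sum (λ i → sum (g i))
  ∑∑-distrib-+ f g = trans (sum-cong-≗ λ i → ∑-distrib-+ (f i) (g i)) (∑-distrib-+ (λ i → sum (f i)) (λ i → sum (g i)))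

  maxᶠ : ∀ {n} → ℕ → (Fin n → ℕ) → ℕ
  maxᶠ {zero}  d f = d
  maxᶠ {suc n} d f = f zero ⊔ maxᶠ d (λ i → f (suc i))

  ≤-maxᶠ : ∀ {n} d (f : Fin n → ℕ) i → f i ≤ maxᶠ d f
  ≤-maxᶠ d f zero    = m≤m⊔n _ _
  ≤-maxᶠ d f (suc i) = ≤-trans (≤-maxᶠ d (λ j → f (suc j)) i) (m≤n⊔m (f zero) _)

  d≤maxᶠ : ∀ {n} d (f : Fin n → ℕ) → d ≤ maxᶠ d f
  d≤maxᶠ {zero}  d f = ≤-refl
  d≤maxᶠ {suc n} d f = ≤-trans (d≤maxᶠ d (λ i → f (suc i))) (m≤n⊔m (f zero) _)

  maxᶠ-preserves : ∀ (P : ℕ → Set) {n} d (f : Fin n → ℕ) → P d → (∀ i → P (f i)) → P (maxᶠ d f)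
  maxᶠ-preserves P {zero}  d f Pd Pf = Pd
  maxᶠ-preserves P {suc n} d f Pd Pf with ⊔-sel (f zero) (maxᶠ d (λ i → f (suc i)))
  ... | inj₁ eq = subst P (sym eq) (Pf zero)
  ... | inj₂ eq = subst P (sym eq) (maxᶠ-preserves P d (λ i → f (suc i)) Pd (λ i → Pf (suc i)))

  count-pos : ∀ {n} (p : Fin n → Bool) {i} → p i ≡ true → 0 < count p
  count-pos p {i} pi≡true = subst (0 <_) (sym (count≡∑ p)) (≤-trans (≤-reflexive (cong ⟦_⟧ (sym pi≡true))) (≤-∑ _ i))

  ∑-except : ∀ {n} (f g : Fin n → ℕ) i → (∀ j → j ≢ i → f j ≡ g j) → sum f + g i ≡ sum g + f i
  ∑-except f g zero f≡g
    rewrite sum-cong-≗ {x = λ j → f (suc j)} {y = λ j → g (suc j)} (λ j → f≡g (suc j) λ ())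
    = swap (f zero) (g zero) (sum (λ j → g (suc j)))
    where
    swap : ∀ x y z → x + z + y ≡ y + z + x
    swap = solve-∀
  ∑-except f g (suc i) f≡g
    rewrite f≡g zero (λ ())
    = trans (+-assoc (g zero) _ _)
        (trans (cong (g zero +_) (∑-except (λ j → f (suc j)) (λ j → g (suc j)) i
                                     λ j j≢i → f≡g (suc j) (λ eq → j≢i (Fin.suc-injective eq))))
          (sym (+-assoc (g zero) _ _)))

module Matchings where
  open import Data.Nat using (ℕ; suc; _+_; _≤_; _<_)
  open import Data.Nat.Properties using (+-*-semiring; ≤-antisym; +-comm; +-identityʳ)
  open import Data.Maybe.Properties using (just-injective)
  open import Data.Fin using (_≟_)
  open import Relation.Nullary using (does)
  open import Algebra.Properties.Semiring.Sum +-*-semiring using (sum)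
  open FiniteSums

  matches : ∀ {b} → Maybe (Fin b) → Fin b → Bool
  matches nothing   r = false
  matches (just r′) r = does (r′ ≟ r)

  matches⇒≡just : ∀ {b} {m : Maybe (Fin b)} {r} → matches m r ≡ true → m ≡ just r
  matches⇒≡just {m = just r′} {r} eq with r′ ≟ r
  ... | yes refl = refl

  matches-just : ∀ {b} (r : Fin b) → matches (just r) r ≡ true
  matches-just r with r ≟ r
  ... | yes _  = refl
  ... | no r≢r = ⊥-elim (r≢r refl)

  ∑-matches : ∀ {b} (m : Maybe (Fin b)) → sum (λ r → ⟦ matches m r ⟧) ≡ ⟦ isJust m ⟧
  ∑-matches {b} nothing   = ∑-≡0 {b} _ (λ _ → refl)
  ∑-matches {b} (just r₀) = ≤-antisym
    (∑-≤1 {b} _ (λ r → ⟦⟧≤1 _) matched-once)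
    (subst (_≤ sum (λ r → ⟦ matches (just r₀) r ⟧)) (cong ⟦_⟧ (matches-just r₀)) (≤-∑ _ r₀))
    where
    matched-once : ∀ r r′ → 0 < ⟦ matches (just r₀) r ⟧ → 0 < ⟦ matches (just r₀) r′ ⟧ → r ≡ r′
    matched-once r r′ p q =
      just-injective (trans (sym (matches⇒≡just {m = just r₀} (⟦⟧-pos p))) (matches⇒≡just (⟦⟧-pos q)))

  ∑-matchedTo≤1 : ∀ {a b} {H : BipGraph a b} {M} → IsMatching H M → ∀ r → sum (λ l → ⟦ matches (M l) r ⟧) ≤ 1
  ∑-matchedTo≤1 M-matching r = ∑-≤1 _ (λ l → ⟦⟧≤1 _)
    λ l l′ p q → IsMatching.inj M-matching l l′ r (matches⇒≡just (⟦⟧-pos p)) (matches⇒≡just (⟦⟧-pos q))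

  _[_]≔_ : ∀ {A : Set} {n} → (Fin n → A) → Fin n → A → Fin n → A
  (f [ i ]≔ v) j with j ≟ i
  ... | yes _ = v
  ... | no  _ = f j

  []≔-updates : ∀ {A : Set} {n} (f : Fin n → A) i v → (f [ i ]≔ v) i ≡ v
  []≔-updates f i v with i ≟ i
  ... | yes _  = refl
  ... | no i≢i = ⊥-elim (i≢i refl)

  []≔-cases : ∀ {A : Set} {n} (f : Fin n → A) i v j → (j ≡ i × (f [ i ]≔ v) j ≡ v) ⊎ (j ≢ i × (f [ i ]≔ v) j ≡ f j)
  []≔-cases f i v j with j ≟ i
  ... | yes j≡i = inj₁ (j≡i , refl)
  ... | no  j≢i = inj₂ (j≢i , refl)

  []≔-minimal : ∀ {A : Set} {n} (f : Fin n → A) {i j} v → j ≢ i → (f [ i ]≔ v) j ≡ f j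
  []≔-minimal f {i} {j} v j≢i with j ≟ i
  ... | yes j≡i = ⊥-elim (j≢i j≡i)
  ... | no  _   = refl

  count-[]≔ : ∀ {A : Set} {n} (p : A → Bool) (f : Fin n → A) i v →
              count (λ x → p ((f [ i ]≔ v) x)) + ⟦ p (f i) ⟧ ≡ count (λ x → p (f x)) + ⟦ p v ⟧
  count-[]≔ p f i v
    rewrite count≡∑ (λ x → p ((f [ i ]≔ v) x)) | count≡∑ (λ x → p (f x))
    = trans (∑-except (λ x → ⟦ p ((f [ i ]≔ v) x) ⟧) (λ x → ⟦ p (f x) ⟧) i unchanged)
            (cong (λ w → _ + ⟦ p w ⟧) ([]≔-updates f i v))
    where
    unchanged : ∀ x → x ≢ i → ⟦ p ((f [ i ]≔ v) x) ⟧ ≡ ⟦ p (f x) ⟧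
    unchanged x x≢i = cong (λ w → ⟦ p w ⟧) ([]≔-minimal f v x≢i)

  size-[]≔just : ∀ {a b} {M : Fin a → Maybe (Fin b)} {l} r → M l ≡ nothing → size (M [ l ]≔ just r) ≡ suc (size M)
  size-[]≔just {M = M} {l} r Ml≡nothing = begin
    size (M [ l ]≔ just r)                        ≡⟨ sym (+-identityʳ _) ⟩
    size (M [ l ]≔ just r) + 0
      ≡⟨ cong (λ m → size (M [ l ]≔ just r) + ⟦ isJust m ⟧) (sym Ml≡nothing) ⟩
    size (M [ l ]≔ just r) + ⟦ isJust (M l) ⟧     ≡⟨ count-[]≔ isJust M l (just r) ⟩
    size M + 1                                    ≡⟨ +-comm (size M) 1 ⟩
    suc (size M)                                  ∎
    where open ≡-Reasoning

  size-[]≔nothing : ∀ {a b} {M : Fin a → Maybe (Fin b)} {l r} → M l ≡ just r → suc (size (M [ l ]≔ nothing)) ≡ size M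
  size-[]≔nothing {M = M} {l} {r} Ml≡just = begin
    suc (size (M [ l ]≔ nothing))                  ≡⟨ +-comm 1 _ ⟩
    size (M [ l ]≔ nothing) + 1
      ≡⟨ cong (λ m → size (M [ l ]≔ nothing) + ⟦ isJust m ⟧) (sym Ml≡just) ⟩
    size (M [ l ]≔ nothing) + ⟦ isJust (M l) ⟧     ≡⟨ count-[]≔ isJust M l nothing ⟩
    size M + 0                                     ≡⟨ +-identityʳ _ ⟩
    size M                                         ∎
    where open ≡-Reasoning

  []≔nothing-isMatching : ∀ {a b} {H : BipGraph a b} {M} i → IsMatching H M → IsMatching H (M [ i ]≔ nothing)
  []≔nothing-isMatching {H = H} {M} i M-matching = record { edges = edges ; inj = inj }
    where
    module M = IsMatching M-matching
    edges : ∀ x r → (M [ i ]≔ nothing) x ≡ just r → H x r ≡ true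
    edges x r eq with x ≟ i
    ... | no _ = M.edges x r eq
    inj : ∀ x y r → (M [ i ]≔ nothing) x ≡ just r → (M [ i ]≔ nothing) y ≡ just r → x ≡ y
    inj x y r eqx eqy with x ≟ i | y ≟ i
    ... | no _ | no _ = M.inj x y r eqx eqy

  []≔just-isMatching : ∀ {a b} {H : BipGraph a b} {M l r} → IsMatching H M → H l r ≡ true → (∀ x → M x ≢ just r) →
                       IsMatching H (M [ l ]≔ just r)
  []≔just-isMatching {H = H} {M} {l} {r} M-matching Hlr r-unused = record { edges = edges ; inj = inj }
    where
    module M = IsMatching M-matching
    edges : ∀ x r′ → (M [ l ]≔ just r) x ≡ just r′ → H x r′ ≡ true
    edges x r′ eq with x ≟ l
    ... | yes refl = subst (λ y → H x y ≡ true) (just-injective eq) Hlr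
    ... | no  _    = M.edges x r′ eq
    inj : ∀ x y r′ → (M [ l ]≔ just r) x ≡ just r′ → (M [ l ]≔ just r) y ≡ just r′ → x ≡ y
    inj x y r′ eqx eqy with x ≟ l | y ≟ l
    ... | yes x≡l | yes y≡l = trans x≡l (sym y≡l)
    ... | yes _   | no  _   = ⊥-elim (r-unused y (trans eqy (sym eqx)))
    ... | no  _   | yes _   = ⊥-elim (r-unused x (trans eqx (sym eqy)))
    ... | no  _   | no  _   = M.inj x y r′ eqx eqy

module König where
  open import Data.Nat hiding (_≟_)
  open import Data.Nat.Properties hiding (_≟_)
  open import Data.Fin using (_≟_)
  open import Data.Fin.Properties using (any?)
  open import Data.Bool.Properties using () renaming (_≟_ to _≟ᵇ_)
  open import Data.Maybe.Properties using (just-injective) renaming (≡-dec to ≡-decᴹ)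
  open import Relation.Nullary.Decidable using (_×-dec_)
  open import Algebra.Properties.Semiring.Sum +-*-semiring using (sum; ∑-comm; ∑-distrib-+; sum-cong-≗)
  open FiniteSums
  open Matchings

  record VertexCover {a b : ℕ} (H : BipGraph a b) (k : ℕ) : Set where
    field
      coverL : Fin a → Bool
      coverR : Fin b → Bool
      covers : ∀ l r → H l r ≡ true → coverL l ≡ true ⊎ coverR r ≡ true
      size≤  : count coverL + count coverR ≤ k

  []≔true-false : ∀ {n} {T : Fin n → Bool} {r r′} → (T [ r ]≔ true) r′ ≡ false → r′ ≢ r × T r′ ≡ false
  []≔true-false {r = r} {r′} eq with r′ ≟ r
  ... | no r′≢r = r′≢r , eq

  []≔true-true : ∀ {n} (T : Fin n → Bool) r {r′} → T r′ ≡ true → (T [ r ]≔ true) r′ ≡ true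
  []≔true-true T r {r′} eq with r′ ≟ r
  ... | yes _ = refl
  ... | no  _ = eq

  module _ {a b} {H : BipGraph a b} {N} (N-maximum : IsMaximumMatching H N) where
    open IsMaximumMatching N-maximum renaming (matching to N-matching)

    -- N′ is N with an alternating path from an unmatched vertex to l flipped; it differs from N
    -- only at right vertices in T.  Carrying N′ instead of the path avoids reasoning about paths.
    record Freeing (T : Fin b → Bool) (l : Fin a) : Set where
      field
        N′          : Fin a → Maybe (Fin b)
        N′-matching : IsMatching H N′
        N′-size     : size N′ ≡ size N
        N′-frees    : N′ l ≡ nothing
        N⇒N′        : ∀ x r → T r ≡ false → N x ≡ just r → N′ x ≡ just r
        N′⇒N        : ∀ x r → T r ≡ false → N′ x ≡ just r → N x ≡ just r

    ¬augmenting : ∀ {T l r} → Freeing T l → H l r ≡ true → T r ≡ false → (∀ x → N x ≢ just r) → ⊥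
    ¬augmenting {T} {l} {r} F Hlr Tr≡false r-unmatched =
      <⇒≱ (subst (size N <_) (sym grown) ≤-refl) (maximum _ extended)
      where
      open Freeing F
      extended : IsMatching H (N′ [ l ]≔ just r)
      extended = []≔just-isMatching N′-matching Hlr (λ x eq → r-unmatched x (N′⇒N x r Tr≡false eq))
      grown : size (N′ [ l ]≔ just r) ≡ suc (size N)
      grown = trans (size-[]≔just {M = N′} r N′-frees) (cong suc N′-size)

    freeing-mono : ∀ {T T′ l} → (∀ r → T′ r ≡ false → T r ≡ false) → Freeing T l → Freeing T′ l
    freeing-mono T′⊆T F = record
      { N′ = N′ ; N′-matching = N′-matching ; N′-size = N′-size ; N′-frees = N′-frees
      ; N⇒N′ = λ x r T′r → N⇒N′ x r (T′⊆T r T′r)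
      ; N′⇒N = λ x r T′r → N′⇒N x r (T′⊆T r T′r)
      }
      where open Freeing F

    freeing-step : ∀ {T l r l′} → Freeing T l → (∀ r′ → N l ≡ just r′ → T r′ ≡ true) →
                   H l r ≡ true → T r ≡ false → N l′ ≡ just r → Freeing (T [ r ]≔ true) l′
    freeing-step {T} {l} {r} {l′} F l-partner-in-T Hlr Tr≡false Nl′≡r = record
      { N′ = N″ ; N′-matching = N″-matching ; N′-size = N″-size ; N′-frees = N″-frees
      ; N⇒N′ = N⇒N″ ; N′⇒N = N″⇒N
      }
      where
      open Freeing F
      N′l′≡r : N′ l′ ≡ just r
      N′l′≡r = N⇒N′ l′ r Tr≡false Nl′≡r

      N₀ N″ : Fin a → Maybe (Fin b)
      N₀ = N′ [ l′ ]≔ nothing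
      N″ = N₀ [ l ]≔ just r

      N₀l≡nothing : N₀ l ≡ nothing
      N₀l≡nothing with l ≟ l′
      ... | yes _ = refl
      ... | no  _ = N′-frees

      r-unused : ∀ x → N₀ x ≢ just r
      r-unused x eq with x ≟ l′
      ... | no x≢l′ = x≢l′ (IsMatching.inj N′-matching x l′ r eq N′l′≡r)

      N″-matching : IsMatching H N″
      N″-matching = []≔just-isMatching ([]≔nothing-isMatching l′ N′-matching) Hlr r-unused

      N″-size : size N″ ≡ size N
      N″-size = trans (size-[]≔just {M = N₀} r N₀l≡nothing) (trans (size-[]≔nothing {M = N′} N′l′≡r) N′-size)

      N″-frees : N″ l′ ≡ nothing
      N″-frees with l′ ≟ l
      ... | yes refl = case trans (sym N′-frees) N′l′≡r of λ ()
      ... | no  _    = []≔-updates N′ l′ nothing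

      N⇒N″ : ∀ x r′ → (T [ r ]≔ true) r′ ≡ false → N x ≡ just r′ → N″ x ≡ just r′
      N⇒N″ x r′ T′r′≡false Nx≡r′ with []≔true-false {T = T} T′r′≡false | x ≟ l
      ... | _    , Tr′≡false | yes refl = case trans (sym (l-partner-in-T r′ Nx≡r′)) Tr′≡false of λ ()
      ... | r′≢r , Tr′≡false | no _ with x ≟ l′
      ...   | yes refl = ⊥-elim (r′≢r (just-injective (trans (sym Nx≡r′) Nl′≡r)))
      ...   | no _     = N⇒N′ x r′ Tr′≡false Nx≡r′

      N″⇒N : ∀ x r′ → (T [ r ]≔ true) r′ ≡ false → N″ x ≡ just r′ → N x ≡ just r′
      N″⇒N x r′ T′r′≡false with []≔true-false {T = T} T′r′≡false | x ≟ l
      ... | r′≢r , _         | yes _ = λ N″x≡r′ → ⊥-elim (r′≢r (sym (just-injective N″x≡r′)))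
      ... | _    , Tr′≡false | no _ with x ≟ l′
      ...   | yes _ = λ ()
      ...   | no  _ = N′⇒N x r′ Tr′≡false

    -- S and T are the left and right vertices reached so far by alternating paths that start
    -- at the left vertices left unmatched by N.
    record Explored (S : Fin a → Bool) (T : Fin b → Bool) : Set where
      field
        partners-in-T  : ∀ l r → S l ≡ true → N l ≡ just r → T r ≡ true
        unmatched-in-S : ∀ l → N l ≡ nothing → S l ≡ true
        T-matched-in-S : ∀ r → T r ≡ true → ∃ λ l → N l ≡ just r × S l ≡ true
        S-freeable     : ∀ l → S l ≡ true → Freeing T l

    explored-unmatched : Explored (λ l → not (isJust (N l))) (λ _ → false)
    explored-unmatched = record
      { partners-in-T  = λ l r Sl Nl≡r → trans (cong (λ m → not (isJust m)) (sym Nl≡r)) Sl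
      ; unmatched-in-S = λ l Nl≡nothing → cong (λ m → not (isJust m)) Nl≡nothing
      ; T-matched-in-S = λ _ ()
      ; S-freeable     = freeable
      }
      where
      freeable : ∀ l → not (isJust (N l)) ≡ true → Freeing (λ _ → false) l
      freeable l Sl = record
        { N′ = N ; N′-matching = N-matching ; N′-size = refl ; N′-frees = unmatched (N l) Sl
        ; N⇒N′ = λ _ _ _ eq → eq ; N′⇒N = λ _ _ _ eq → eq
        }
        where
        unmatched : ∀ m → not (isJust m) ≡ true → m ≡ nothing
        unmatched nothing _ = refl

    explore : ∀ {S T l r l′} → Explored S T → S l ≡ true → H l r ≡ true → T r ≡ false → N l′ ≡ just r →
              Explored (S [ l′ ]≔ true) (T [ r ]≔ true)
    explore {S} {T} {l} {r} {l′} E Sl Hlr Tr≡false Nl′≡r = record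
      { partners-in-T  = partners-in-T′
      ; unmatched-in-S = λ x Nx → []≔true-true S l′ (unmatched-in-S x Nx)
      ; T-matched-in-S = T-matched-in-S′
      ; S-freeable     = S-freeable′
      }
      where
      open Explored E
      partners-in-T′ : ∀ x y → (S [ l′ ]≔ true) x ≡ true → N x ≡ just y → (T [ r ]≔ true) y ≡ true
      partners-in-T′ x y S′x Nx≡y with []≔-cases S l′ true x
      ... | inj₁ (refl , _) = subst (λ z → (T [ r ]≔ true) z ≡ true) (just-injective (trans (sym Nl′≡r) Nx≡y)) ([]≔-updates T r true)
      ... | inj₂ (_ , eq)   = []≔true-true T r (partners-in-T x y (trans (sym eq) S′x) Nx≡y)

      T-matched-in-S′ : ∀ y → (T [ r ]≔ true) y ≡ true → ∃ λ x → N x ≡ just y × (S [ l′ ]≔ true) x ≡ true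
      T-matched-in-S′ y T′y with []≔-cases T r true y
      ... | inj₁ (refl , _) = l′ , Nl′≡r , []≔-updates S l′ true
      ... | inj₂ (_ , eq) with T-matched-in-S y (trans (sym eq) T′y)
      ...   | x , Nx≡y , Sx = x , Nx≡y , []≔true-true S l′ Sx

      S-freeable′ : ∀ x → (S [ l′ ]≔ true) x ≡ true → Freeing (T [ r ]≔ true) x
      S-freeable′ x S′x with []≔-cases S l′ true x
      ... | inj₁ (refl , _) = freeing-step (S-freeable l Sl) (λ r′ → partners-in-T l r′ Sl) Hlr Tr≡false Nl′≡r
      ... | inj₂ (_ , eq)   = freeing-mono (λ y T′y → proj₂ ([]≔true-false {T = T} T′y)) (S-freeable x (trans (sym eq) S′x))

    explored-size : ∀ {S T} → Explored S T → count (λ l → not (S l)) + count T ≤ size N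
    explored-size {S} {T} E rewrite count≡∑ (λ l → not (S l)) | count≡∑ T | count≡∑ (λ l → isJust (N l)) = begin
      sum (λ l → ⟦ not (S l) ⟧) + sum (λ r → ⟦ T r ⟧)
        ≤⟨ +-monoʳ-≤ (sum (λ l → ⟦ not (S l) ⟧)) (∑-mono-≤ T≤μ) ⟩
      sum (λ l → ⟦ not (S l) ⟧) + sum (λ r → sum (λ l → μ l r))
        ≡⟨ cong (sum (λ l → ⟦ not (S l) ⟧) +_) (∑-comm μ) ⟨
      sum (λ l → ⟦ not (S l) ⟧) + sum (λ l → sum (μ l))
        ≡⟨ cong (sum (λ l → ⟦ not (S l) ⟧) +_) (sum-cong-≗ λ l →
             trans (∑-*ˡ ⟦ S l ⟧ (λ r → ⟦ matches (N l) r ⟧)) (cong (⟦ S l ⟧ *_) (∑-matches (N l)))) ⟩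
      sum (λ l → ⟦ not (S l) ⟧) + sum (λ l → ⟦ S l ⟧ * ⟦ isJust (N l) ⟧)
        ≡⟨ ∑-distrib-+ (λ l → ⟦ not (S l) ⟧) (λ l → ⟦ S l ⟧ * ⟦ isJust (N l) ⟧) ⟨
      sum (λ l → ⟦ not (S l) ⟧ + ⟦ S l ⟧ * ⟦ isJust (N l) ⟧)
        ≤⟨ ∑-mono-≤ S-matched ⟩
      sum (λ l → ⟦ isJust (N l) ⟧) ∎
      where
      open Explored E
      open ≤-Reasoning
      μ : Fin a → Fin b → ℕ
      μ l r = ⟦ S l ⟧ * ⟦ matches (N l) r ⟧

      T≤μ : ∀ r → ⟦ T r ⟧ ≤ sum (λ l → μ l r)
      T≤μ r with T r in Tr
      ... | false = z≤n
      ... | true with T-matched-in-S r Tr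
      ...   | l , Nl≡r , Sl = subst (_≤ sum (λ l → μ l r)) μlr≡1 (≤-∑ (λ l → μ l r) l)
        where
        μlr≡1 : μ l r ≡ 1
        μlr≡1 rewrite Sl | Nl≡r | matches-just r = refl

      S-matched : ∀ l → ⟦ not (S l) ⟧ + ⟦ S l ⟧ * ⟦ isJust (N l) ⟧ ≤ ⟦ isJust (N l) ⟧
      S-matched l with S l in Sl | N l in Nl
      ... | true  | m       = ≤-reflexive (+-identityʳ ⟦ isJust m ⟧)
      ... | false | just _  = ≤-refl
      ... | false | nothing = case trans (sym (unmatched-in-S l Nl)) Sl of λ ()

    explored-cover : ∀ {S T} → Explored S T → (∀ l r → S l ≡ true → H l r ≡ true → T r ≡ false → ⊥) →
                     VertexCover H (size N)
    explored-cover {S} {T} E closed = record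
      { coverL = λ l → not (S l) ; coverR = T ; covers = covers ; size≤ = explored-size E }
      where
      covers : ∀ l r → H l r ≡ true → not (S l) ≡ true ⊎ T r ≡ true
      covers l r Hlr with S l in Sl | T r in Tr
      ... | false | _     = inj₁ refl
      ... | true  | true  = inj₂ refl
      ... | true  | false = ⊥-elim (closed l r Sl Hlr Tr)

    search : ∀ fuel {S T} → Explored S T → count (λ r → not (T r)) ≤ fuel → VertexCover H (size N)
    search zero {T = T} E unexplored≤0 =
      explored-cover E λ l r _ _ Tr≡false → <⇒≱ (count-pos (λ r → not (T r)) (cong not Tr≡false)) unexplored≤0
    search (suc fuel) {S} {T} E unexplored≤fuel
      with any? (λ l → any? (λ r → (S l ≟ᵇ true) ×-dec (H l r ≟ᵇ true) ×-dec (T r ≟ᵇ false)))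
    ... | no ¬edge = explored-cover E λ l r Sl Hlr Tr → ¬edge (l , r , Sl , Hlr , Tr)
    ... | yes (l , r , Sl , Hlr , Tr≡false) with any? (λ x → ≡-decᴹ _≟_ (N x) (just r))
    ...   | no r-unmatched =
            ⊥-elim (¬augmenting (Explored.S-freeable E l Sl) Hlr Tr≡false λ x eq → r-unmatched (x , eq))
    ...   | yes (l′ , Nl′≡r) =
            search fuel (explore E Sl Hlr Tr≡false Nl′≡r) (≤-pred (subst (_≤ suc fuel) (sym shrinks) unexplored≤fuel))
      where
      open ≡-Reasoning
      shrinks : suc (count (λ y → not ((T [ r ]≔ true) y))) ≡ count (λ y → not (T y))
      shrinks = begin
        suc (count (λ y → not ((T [ r ]≔ true) y)))             ≡⟨ +-comm 1 _ ⟩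
        count (λ y → not ((T [ r ]≔ true) y)) + ⟦ not false ⟧
          ≡⟨ cong (λ t → count (λ y → not ((T [ r ]≔ true) y)) + ⟦ not t ⟧) (sym Tr≡false) ⟩
        count (λ y → not ((T [ r ]≔ true) y)) + ⟦ not (T r) ⟧   ≡⟨ count-[]≔ not T r true ⟩
        count (λ y → not (T y)) + 0                             ≡⟨ +-identityʳ _ ⟩
        count (λ y → not (T y))                                 ∎

    vertexCover : VertexCover H (size N)
    vertexCover = search _ explored-unmatched ≤-refl

module DegreeCounting where
  open import Data.Nat
  open import Data.Nat.Properties
  open import Data.Nat.Tactic.RingSolver using (solve-∀)
  open import Algebra.Properties.Semiring.Sum +-*-semiring using (sum; ∑-comm; ∑-distrib-+; sum-cong-≗)
  open FiniteSums
  open Matchings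

  m≤n⇒2mn≤m²+n² : ∀ {m n} → m ≤ n → 2 * m * n ≤ m * m + n * n
  m≤n⇒2mn≤m²+n² {m} {n} m≤n = subst (λ k → 2 * m * k ≤ m * m + k * k) (m+[n∸m]≡n m≤n) (gap m (n ∸ m))
    where
    gap : ∀ m d → 2 * m * (m + d) ≤ m * m + (m + d) * (m + d)
    gap m d = subst (2 * m * (m + d) ≤_) (square m d) (m≤m+n _ (d * d))
      where
      square : ∀ m d → 2 * m * (m + d) + d * d ≡ m * m + (m + d) * (m + d)
      square = solve-∀

  2mn≤m²+n² : ∀ m n → 2 * m * n ≤ m * m + n * n
  2mn≤m²+n² m n with ≤-total m n
  ... | inj₁ m≤n = m≤n⇒2mn≤m²+n² m≤n
  ... | inj₂ n≤m = subst₂ _≤_ (swap n m) (+-comm (n * n) (m * m)) (m≤n⇒2mn≤m²+n² n≤m)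
    where
    swap : ∀ n m → 2 * n * m ≡ 2 * m * n
    swap = solve-∀

  4Bx≤4x²+B² : ∀ B x → 4 * B * x ≤ 4 * (x * x) + B * B
  4Bx≤4x²+B² B x = subst₂ _≤_ (lhs B x) (rhs B x) (2mn≤m²+n² (2 * x) B)
    where
    lhs : ∀ B x → 2 * (2 * x) * B ≡ 4 * B * x
    lhs = solve-∀
    rhs : ∀ B x → 2 * x * (2 * x) + B * B ≡ 4 * (x * x) + B * B
    rhs = solve-∀

  4Bx≤4x²+cB² : ∀ B x {c} → (0 < x → 1 ≤ c) → 4 * B * x ≤ 4 * (x * x) + c * (B * B)
  4Bx≤4x²+cB² B zero {c} _ = subst (_≤ c * (B * B)) (sym (*-zeroʳ (4 * B))) z≤n
  4Bx≤4x²+cB² B (suc x) 1≤c = ≤-trans (4Bx≤4x²+B² B (suc x))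
    (+-monoʳ-≤ (4 * (suc x * suc x)) (≤-trans (≤-reflexive (sym (*-identityˡ (B * B)))) (*-monoˡ-≤ (B * B) (1≤c (s≤s z≤n)))))

  4Bσx≤4σx²+σB² : ∀ B x {σ} → σ ≤ 1 → 4 * B * (σ * x) ≤ 4 * (σ * x * x) + σ * (B * B)
  4Bσx≤4σx²+σB² B x z≤n       = subst (_≤ 0) (sym (*-zeroʳ (4 * B))) z≤n
  4Bσx≤4σx²+σB² B x (s≤s z≤n) = subst₂ _≤_ (lhs B x) (rhs B x) (4Bx≤4x²+B² B x)
    where
    lhs : ∀ B x → 4 * B * x ≡ 4 * B * (1 * x)
    lhs = solve-∀
    rhs : ∀ B x → 4 * (x * x) + B * B ≡ 4 * (1 * x * x) + 1 * (B * B)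
    rhs = solve-∀

  0<m*n⇒0<m : ∀ m {n} → 0 < m * n → 0 < m
  0<m*n⇒0<m m 0<mn = >-nonZero⁻¹ m {{m*n≢0⇒m≢0 m {{>-nonZero 0<mn}}}}

  0<m*n⇒0<n : ∀ m {n} → 0 < m * n → 0 < n
  0<m*n⇒0<n m {n} 0<mn = >-nonZero⁻¹ n {{m*n≢0⇒n≢0 m {{>-nonZero 0<mn}}}}

  cancel-two-bounds : ∀ {x u v p q} → x ≤ 4 * u + p → x ≤ 4 * v + q → 4 * (u + v) ≤ x → x ≤ p + q
  cancel-two-bounds {x} {u} {v} {p} {q} x≤u x≤v 4uv≤x = +-cancelˡ-≤ x x (p + q) (begin
    x + x                   ≤⟨ +-mono-≤ x≤u x≤v ⟩
    4 * u + p + (4 * v + q) ≡⟨ regroup u v p q ⟩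
    4 * (u + v) + (p + q)   ≤⟨ +-monoˡ-≤ (p + q) 4uv≤x ⟩
    x + (p + q)             ∎)
    where
    open ≤-Reasoning
    regroup : ∀ u v p q → 4 * u + p + (4 * v + q) ≡ 4 * (u + v) + (p + q)
    regroup = solve-∀

  EdgeDegreeBound : ∀ {a b} → BipGraph a b → ℕ → Set
  EdgeDegreeBound H B = ∀ l r → H l r ≡ true → degL H l + degR H r ≤ B

  -- Non-edges contribute 1, which keeps the bound positive even for an edgeless graph.
  maxEdgeDegree : ∀ {a b} → BipGraph a b → ℕ
  maxEdgeDegree H = maxᶠ 1 (λ l → maxᶠ 1 (λ r → if H l r then degL H l + degR H r else 1))

  maxEdgeDegree-bound : ∀ {a b} (H : BipGraph a b) → EdgeDegreeBound H (maxEdgeDegree H)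
  maxEdgeDegree-bound H l r Hlr = ≤-trans (≤-reflexive (cong (λ e → if e then degL H l + degR H r else 1) (sym Hlr)))
    (≤-trans (≤-maxᶠ 1 _ r) (≤-maxᶠ 1 (λ l → maxᶠ 1 (λ r → if H l r then degL H l + degR H r else 1)) l))

  1≤maxEdgeDegree : ∀ {a b} (H : BipGraph a b) → 1 ≤ maxEdgeDegree H
  1≤maxEdgeDegree H = d≤maxᶠ 1 (λ l → maxᶠ 1 (λ r → if H l r then degL H l + degR H r else 1))

  module _ {a b} (H : BipGraph a b) {B} (bounded : EdgeDegreeBound H B) where
    private
      h : Fin a → Fin b → ℕ
      h l r = ⟦ H l r ⟧
      dL : Fin a → ℕ
      dL = degL H
      dR : Fin b → ℕ
      dR = degR H

    module _ (C : Fin b → Bool) (σ : Fin a → ℕ) (σ≤1 : ∀ l → σ l ≤ 1)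
             (neighbours-in-C : ∀ l r → 0 < σ l → H l r ≡ true → C r ≡ true) where
      private
        open ≤-Reasoning
        P : ℕ
        P = sum (λ l → σ l * dL l)
        y : Fin b → ℕ
        y r = sum (λ l → σ l * h l r)

        ∑∑σh≡P : sum (λ l → sum (λ r → σ l * h l r)) ≡ P
        ∑∑σh≡P = sum-cong-≗ λ l → trans (∑-*ˡ (σ l) (h l)) (cong (σ l *_) (sym (count≡∑ (H l))))

        left-bound : 4 * B * P ≤ 4 * sum (λ l → σ l * dL l * dL l) + sum σ * (B * B)
        left-bound = begin
          4 * B * P
            ≡⟨ ∑-*ˡ (4 * B) (λ l → σ l * dL l) ⟨
          sum (λ l → 4 * B * (σ l * dL l))
            ≤⟨ ∑-mono-≤ (λ l → 4Bσx≤4σx²+σB² B (dL l) (σ≤1 l)) ⟩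
          sum (λ l → 4 * (σ l * dL l * dL l) + σ l * (B * B))
            ≡⟨ ∑-distrib-+ (λ l → 4 * (σ l * dL l * dL l)) (λ l → σ l * (B * B)) ⟩
          sum (λ l → 4 * (σ l * dL l * dL l)) + sum (λ l → σ l * (B * B))
            ≡⟨ cong₂ _+_ (∑-*ˡ 4 (λ l → σ l * dL l * dL l)) (∑-*ʳ (B * B) σ) ⟩
          4 * sum (λ l → σ l * dL l * dL l) + sum σ * (B * B)               ∎

        y-supported : ∀ r → 0 < y r → 1 ≤ ⟦ C r ⟧
        y-supported r 0<y with ∑-pos _ 0<y
        ... | l , 0<σh rewrite neighbours-in-C l r (0<m*n⇒0<m (σ l) 0<σh) (⟦⟧-pos (0<m*n⇒0<n (σ l) 0<σh)) = ≤-refl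

        right-bound : 4 * B * P ≤ 4 * sum (λ r → y r * y r) + count C * (B * B)
        right-bound = begin
          4 * B * P
            ≡⟨ cong (4 * B *_) (trans (sym ∑∑σh≡P) (∑-comm (λ l r → σ l * h l r))) ⟩
          4 * B * sum y                                                      ≡⟨ ∑-*ˡ (4 * B) y ⟨
          sum (λ r → 4 * B * y r)
            ≤⟨ ∑-mono-≤ (λ r → 4Bx≤4x²+cB² B (y r) (y-supported r)) ⟩
          sum (λ r → 4 * (y r * y r) + ⟦ C r ⟧ * (B * B))
            ≡⟨ ∑-distrib-+ (λ r → 4 * (y r * y r)) (λ r → ⟦ C r ⟧ * (B * B)) ⟩
          sum (λ r → 4 * (y r * y r)) + sum (λ r → ⟦ C r ⟧ * (B * B))
            ≡⟨ cong₂ _+_ (∑-*ˡ 4 (λ r → y r * y r)) (trans (∑-*ʳ (B * B) (λ r → ⟦ C r ⟧)) (cong (_* (B * B)) (sym (count≡∑ C)))) ⟩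
          4 * sum (λ r → y r * y r) + count C * (B * B)                      ∎

        y≤dR : ∀ r → y r ≤ dR r
        y≤dR r = subst (y r ≤_) (sym (count≡∑ (λ l → H l r)))
          (∑-mono-≤ λ l → ≤-trans (*-monoˡ-≤ (h l r) (σ≤1 l)) (≤-reflexive (*-identityˡ (h l r))))

        edge-bound : ∀ l r → σ l * ⟦ H l r ⟧ * (dL l + dR r) ≤ B * (σ l * ⟦ H l r ⟧)
        edge-bound l r with H l r in Hlr
        ... | false = subst (_≤ B * (σ l * 0)) (sym (no-edge (σ l) (dL l + dR r))) z≤n
          where
          no-edge : ∀ σ D → σ * 0 * D ≡ 0
          no-edge = solve-∀
        ... | true  = subst (σ l * 1 * (dL l + dR r) ≤_) (*-comm (σ l * 1) B) (*-monoʳ-≤ (σ l * 1) (bounded l r Hlr))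

        edges≡squares : sum (λ l → sum (λ r → σ l * h l r * (dL l + dR r))) ≡
                        sum (λ l → σ l * dL l * dL l) + sum (λ r → dR r * y r)
        edges≡squares = begin-equality
          sum (λ l → sum (λ r → σ l * h l r * (dL l + dR r)))
            ≡⟨ sum-cong-≗ (λ l → sum-cong-≗ (λ r → split (σ l) (h l r) (dL l) (dR r))) ⟩
          sum (λ l → sum (λ r → σ l * dL l * h l r + dR r * (σ l * h l r)))
            ≡⟨ sum-cong-≗ (λ l → ∑-distrib-+ (λ r → σ l * dL l * h l r) (λ r → dR r * (σ l * h l r))) ⟩
          sum (λ l → sum (λ r → σ l * dL l * h l r) + sum (λ r → dR r * (σ l * h l r)))
            ≡⟨ ∑-distrib-+ (λ l → sum (λ r → σ l * dL l * h l r)) (λ l → sum (λ r → dR r * (σ l * h l r))) ⟩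
          sum (λ l → sum (λ r → σ l * dL l * h l r)) + sum (λ l → sum (λ r → dR r * (σ l * h l r)))
            ≡⟨ cong₂ _+_ (sum-cong-≗ λ l → trans (∑-*ˡ (σ l * dL l) (h l)) (cong (σ l * dL l *_) (sym (count≡∑ (H l)))))
                         (trans (∑-comm (λ l r → dR r * (σ l * h l r))) (sum-cong-≗ λ r → ∑-*ˡ (dR r) (λ l → σ l * h l r))) ⟩
          sum (λ l → σ l * dL l * dL l) + sum (λ r → dR r * y r) ∎
          where
          split : ∀ σ h d e → σ * h * (d + e) ≡ σ * d * h + e * (σ * h)
          split = solve-∀

        squares≤BP : sum (λ l → σ l * dL l * dL l) + sum (λ r → y r * y r) ≤ B * P
        squares≤BP = begin
          sum (λ l → σ l * dL l * dL l) + sum (λ r → y r * y r)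
            ≤⟨ +-monoʳ-≤ (sum (λ l → σ l * dL l * dL l)) (∑-mono-≤ λ r → *-monoˡ-≤ (y r) (y≤dR r)) ⟩
          sum (λ l → σ l * dL l * dL l) + sum (λ r → dR r * y r)
            ≡⟨ edges≡squares ⟨
          sum (λ l → sum (λ r → σ l * h l r * (dL l + dR r)))
            ≤⟨ ∑-mono-≤ (λ l → ∑-mono-≤ (edge-bound l)) ⟩
          sum (λ l → sum (λ r → B * (σ l * h l r)))
            ≡⟨ sum-cong-≗ (λ l → ∑-*ˡ B (λ r → σ l * h l r)) ⟩
          sum (λ l → B * sum (λ r → σ l * h l r))
          ≡⟨ ∑-*ˡ B (λ l → sum (λ r → σ l * h l r)) ⟩
          B * sum (λ l → sum (λ r → σ l * h l r))
          ≡⟨ cong (B *_) ∑∑σh≡P ⟩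
          B * P ∎

      -- Let A be the support of σ and y r the number of H-edges from A to r.  Summing
      -- deg l + deg r ≤ B over the edges leaving A bounds Σ_A (deg l)² + Σ_C (y r)² by B·P;
      -- adding 4BP ≤ 4 Σ_A (deg l)² + |A|B² and 4BP ≤ 4 Σ_C (y r)² + |C|B², both instances
      -- of 4Bx ≤ 4x² + B², then leaves 4BP ≤ (|A| + |C|)B².
      load-bound : 4 * B * sum (λ l → σ l * dL l) ≤ (sum σ + count C) * (B * B)
      load-bound =
        subst (4 * B * P ≤_) (sym (*-distribʳ-+ (B * B) (sum σ) (count C)))
          (cancel-two-bounds {u = sum (λ l → σ l * dL l * dL l)} {v = sum (λ r → y r * y r)} left-bound right-bound
            (≤-trans (*-monoʳ-≤ 4 squares≤BP) (≤-reflexive (sym (*-assoc 4 B P)))))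

  transpose : ∀ {a b} → BipGraph a b → BipGraph b a
  transpose H r l = H l r

  module _ {a b} (H : BipGraph a b) (coverL : Fin a → Bool) (coverR : Fin b → Bool)
           (covers : ∀ l r → H l r ≡ true → coverL l ≡ true ⊎ coverR r ≡ true)
           {B} (bounded : EdgeDegreeBound H B) (U : Fin a → Fin b → Bool)
           (U-rows : ∀ l → sum (λ r → ⟦ U l r ⟧) ≤ 1) (U-columns : ∀ r → sum (λ l → ⟦ U l r ⟧) ≤ 1)
           (U-uncovered : ∀ l r → U l r ≡ true → coverL l ≡ false × coverR r ≡ false) where
    private
      σL : Fin a → ℕ
      σL l = sum (λ r → ⟦ U l r ⟧)
      σR : Fin b → ℕ
      σR r = sum (λ l → ⟦ U l r ⟧)

      left-neighbours : ∀ l r → 0 < σL l → H l r ≡ true → coverR r ≡ true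
      left-neighbours l r 0<σ Hlr with ∑⟦⟧-pos (U l) 0<σ | covers l r Hlr
      ... | r′ , Ulr′ | inj₁ cLl = case trans (sym cLl) (proj₁ (U-uncovered l r′ Ulr′)) of λ ()
      ... | _         | inj₂ cRr = cRr

      right-neighbours : ∀ r l → 0 < σR r → H l r ≡ true → coverL l ≡ true
      right-neighbours r l 0<σ Hlr with ∑⟦⟧-pos (λ l → U l r) 0<σ | covers l r Hlr
      ... | _ , _          | inj₁ cLl = cLl
      ... | l′ , Ul′r      | inj₂ cRr = case trans (sym cRr) (proj₂ (U-uncovered l′ r Ul′r)) of λ ()

      transpose-bounded : EdgeDegreeBound (transpose H) B
      transpose-bounded r l Hlr = subst (_≤ B) (+-comm (degL H l) (degR H r)) (bounded l r Hlr)

      U-degrees : sum (λ l → sum (λ r → ⟦ U l r ⟧ * (degL H l + degR H r))) ≡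
                  sum (λ l → σL l * degL H l) + sum (λ r → σR r * degR H r)
      U-degrees = begin-equality
        sum (λ l → sum (λ r → ⟦ U l r ⟧ * (degL H l + degR H r)))
          ≡⟨ sum-cong-≗ (λ l → sum-cong-≗ λ r → *-distribˡ-+ ⟦ U l r ⟧ (degL H l) (degR H r)) ⟩
        sum (λ l → sum (λ r → ⟦ U l r ⟧ * degL H l + ⟦ U l r ⟧ * degR H r))
          ≡⟨ ∑∑-distrib-+ (λ l r → ⟦ U l r ⟧ * degL H l) (λ l r → ⟦ U l r ⟧ * degR H r) ⟩
        sum (λ l → sum (λ r → ⟦ U l r ⟧ * degL H l)) + sum (λ l → sum (λ r → ⟦ U l r ⟧ * degR H r))
          ≡⟨ cong₂ _+_ (sum-cong-≗ λ l → ∑-*ʳ (degL H l) (λ r → ⟦ U l r ⟧))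
                       (trans (∑-comm (λ l r → ⟦ U l r ⟧ * degR H r)) (sum-cong-≗ λ r → ∑-*ʳ (degR H r) (λ l → ⟦ U l r ⟧))) ⟩
        sum (λ l → σL l * degL H l) + sum (λ r → σR r * degR H r) ∎
        where open ≤-Reasoning

      degree-bound·B :
        4 * B * sum (λ l → sum (λ r → ⟦ U l r ⟧ * (degL H l + degR H r))) ≤
        (2 * sum σL + (count coverL + count coverR)) * (B * B)
      degree-bound·B = begin
        4 * B * sum (λ l → sum (λ r → ⟦ U l r ⟧ * (degL H l + degR H r)))
          ≡⟨ cong (4 * B *_) U-degrees ⟩
        4 * B * (sum (λ l → σL l * degL H l) + sum (λ r → σR r * degR H r))
          ≡⟨ *-distribˡ-+ (4 * B) _ _ ⟩
        4 * B * sum (λ l → σL l * degL H l) + 4 * B * sum (λ r → σR r * degR H r)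
          ≤⟨ +-mono-≤ (load-bound H bounded coverR σL U-rows left-neighbours)
                      (load-bound (transpose H) transpose-bounded coverL σR U-columns right-neighbours) ⟩
        (sum σL + count coverR) * (B * B) + (sum σR + count coverL) * (B * B)
          ≡⟨ cong (λ t → (sum σL + count coverR) * (B * B) + (t + count coverL) * (B * B)) (sym (∑-comm (λ l r → ⟦ U l r ⟧))) ⟩
        (sum σL + count coverR) * (B * B) + (sum σL + count coverL) * (B * B)
          ≡⟨ regroup (sum σL) (count coverL) (count coverR) (B * B) ⟩
        (2 * sum σL + (count coverL + count coverR)) * (B * B) ∎
        where
        open ≤-Reasoning
        regroup : ∀ s cL cR B² → (s + cR) * B² + (s + cL) * B² ≡ (2 * s + (cL + cR)) * B²
        regroup = solve-∀

    uncovered-degree-bound : 1 ≤ B →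
      4 * sum (λ l → sum (λ r → ⟦ U l r ⟧ * (degL H l + degR H r))) ≤ (2 * sum σL + (count coverL + count coverR)) * B
    uncovered-degree-bound 1≤B = *-cancelˡ-≤ B {{>-nonZero 1≤B}}
      (subst₂ _≤_ (reassoc B _) (shuffle (2 * sum σL + (count coverL + count coverR)) B) degree-bound·B)
      where
      reassoc : ∀ B f → 4 * B * f ≡ B * (4 * f)
      reassoc = solve-∀
      shuffle : ∀ c B → c * (B * B) ≡ B * (c * B)
      shuffle = solve-∀

  module _ {a b} {G : BipGraph a b} {M} (M-matching : IsMatching G M)
           (coverL : Fin a → Bool) (coverR : Fin b → Bool) where
    uncovered : Fin a → Fin b → Bool
    uncovered l r = matches (M l) r ∧ not (coverL l ∨ coverR r)

    private
      μ : Fin a → Fin b → ℕ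
      μ l r = ⟦ matches (M l) r ⟧

      μ≤ : ∀ l r → ⟦ uncovered l r ⟧ ≤ μ l r
      μ≤ l r with matches (M l) r
      ... | true  = ⟦⟧≤1 _
      ... | false = z≤n

      μ-split : ∀ m c d → ⟦ m ⟧ ≤ ⟦ c ⟧ * ⟦ m ⟧ + ⟦ d ⟧ * ⟦ m ⟧ + ⟦ m ∧ not (c ∨ d) ⟧
      μ-split false c     d     = z≤n
      μ-split true  true  d     = s≤s z≤n
      μ-split true  false true  = s≤s z≤n
      μ-split true  false false = s≤s z≤n

      *≤1 : ∀ c {x} → x ≤ 1 → c * x ≤ c
      *≤1 c x≤1 = ≤-trans (*-monoʳ-≤ c x≤1) (≤-reflexive (*-identityʳ c))

    uncovered-rows : ∀ l → sum (λ r → ⟦ uncovered l r ⟧) ≤ 1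
    uncovered-rows l = ≤-trans (∑-mono-≤ (μ≤ l)) (subst (_≤ 1) (sym (∑-matches (M l))) (⟦⟧≤1 _))

    uncovered-columns : ∀ r → sum (λ l → ⟦ uncovered l r ⟧) ≤ 1
    uncovered-columns r = ≤-trans (∑-mono-≤ (λ l → μ≤ l r)) (∑-matchedTo≤1 M-matching r)

    uncovered-avoids : ∀ l r → uncovered l r ≡ true → coverL l ≡ false × coverR r ≡ false
    uncovered-avoids l r eq with matches (M l) r | coverL l | coverR r
    ... | true | false | false = refl , refl

    uncovered-matched : ∀ l r → uncovered l r ≡ true → M l ≡ just r
    uncovered-matched l r eq with matches (M l) r in Mlr
    ... | true = matches⇒≡just Mlr

    size≤cover+uncovered : size M ≤ count coverL + count coverR + sum (λ l → sum (λ r → ⟦ uncovered l r ⟧))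
    size≤cover+uncovered = begin
      size M                                                                  ≡⟨ count≡∑ (λ l → isJust (M l)) ⟩
      sum (λ l → ⟦ isJust (M l) ⟧)                                            ≡⟨ sum-cong-≗ (λ l → ∑-matches (M l)) ⟨
      sum (λ l → sum (μ l))                                                   ≤⟨ ∑-mono-≤ (λ l → ∑-mono-≤ (split l)) ⟩
      sum (λ l → sum (λ r → cL l r + cR l r + u l r))                         ≡⟨ ∑∑-distrib-+ (λ l r → cL l r + cR l r) u ⟩
      sum (λ l → sum (λ r → cL l r + cR l r)) + ∑u                            ≡⟨ cong (_+ ∑u) (∑∑-distrib-+ cL cR) ⟩
      ∑∑L + ∑∑R + ∑u                                                          ≤⟨ +-monoˡ-≤ ∑u (+-mono-≤ left right) ⟩
      count coverL + count coverR + ∑u                                        ∎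
      where
      open ≤-Reasoning
      u cL cR : Fin a → Fin b → ℕ
      u l r  = ⟦ uncovered l r ⟧
      cL l r = ⟦ coverL l ⟧ * μ l r
      cR l r = ⟦ coverR r ⟧ * μ l r
      ∑u ∑∑L ∑∑R : ℕ
      ∑u  = sum (λ l → sum (u l))
      ∑∑L = sum (λ l → sum (cL l))
      ∑∑R = sum (λ l → sum (cR l))

      split : ∀ l r → μ l r ≤ cL l r + cR l r + u l r
      split l r = μ-split (matches (M l) r) (coverL l) (coverR r)

      left : ∑∑L ≤ count coverL
      left = begin
        sum (λ l → sum (λ r → ⟦ coverL l ⟧ * μ l r)) ≡⟨ sum-cong-≗ (λ l → ∑-*ˡ ⟦ coverL l ⟧ (μ l)) ⟩
        sum (λ l → ⟦ coverL l ⟧ * sum (μ l))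
          ≤⟨ ∑-mono-≤ (λ l → *≤1 ⟦ coverL l ⟧ (subst (_≤ 1) (sym (∑-matches (M l))) (⟦⟧≤1 _))) ⟩
        sum (λ l → ⟦ coverL l ⟧)                     ≡⟨ count≡∑ coverL ⟨
        count coverL                                 ∎
      right : ∑∑R ≤ count coverR
      right = begin
        sum (λ l → sum (λ r → ⟦ coverR r ⟧ * μ l r)) ≡⟨ ∑-comm (λ l r → ⟦ coverR r ⟧ * μ l r) ⟩
        sum (λ r → sum (λ l → ⟦ coverR r ⟧ * μ l r)) ≡⟨ sum-cong-≗ (λ r → ∑-*ˡ ⟦ coverR r ⟧ (λ l → μ l r)) ⟩
        sum (λ r → ⟦ coverR r ⟧ * sum (λ l → μ l r)) ≤⟨ ∑-mono-≤ (λ r → *≤1 ⟦ coverR r ⟧ (∑-matchedTo≤1 M-matching r)) ⟩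
        sum (λ r → ⟦ coverR r ⟧)                     ≡⟨ count≡∑ coverR ⟨
        count coverR                                 ∎

module RationalArithmetic where
  open import Data.Nat as ℕ using (ℕ; zero; suc; z≤n)
  import Data.Nat.Properties as ℕ
  open import Data.Integer as ℤ using (+_; +≤+)
  import Data.Integer.Properties as ℤ
  open import Data.Rational using (ℚ; _/_; 0ℚ; 1ℚ; ½; _≤_; _<_; _+_; _*_; _-_; -_; toℚᵘ; nonNegative; positive)
  import Data.Rational.Properties as ℚ
  open import Data.Rational.Unnormalised as ℚᵘ using (mkℚᵘ; *≡*; *≤*)
  import Data.Rational.Unnormalised.Properties as ℚᵘ
  open import Data.Nat.Coprimality using (1-coprimeTo) renaming (sym to coprime-sym)
  open import Data.Rational.Solver using (module +-*-Solver)
  open import Data.Unit using (tt)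
  open import Algebra.Properties.Semiring.Sum ℕ.+-*-semiring using (sum)
  open +-*-Solver using (solve; _:+_; _:*_; _:-_; _:=_; con)
  open FiniteSums using (⟦_⟧)

  toℚᵘ-toℚ : ∀ n → toℚᵘ (toℚ n) ≡ mkℚᵘ (+ n) 0
  toℚᵘ-toℚ n = cong toℚᵘ (ℚ.normalize-coprime (coprime-sym (1-coprimeTo n)))

  toℚ-mono-≤ : ∀ {m n} → m ℕ.≤ n → toℚ m ≤ toℚ n
  toℚ-mono-≤ {m} {n} m≤n = ℚ.toℚᵘ-cancel-≤ (subst₂ ℚᵘ._≤_ (sym (toℚᵘ-toℚ m)) (sym (toℚᵘ-toℚ n))
    (*≤* (subst₂ ℤ._≤_ (sym (ℤ.*-identityʳ (+ m))) (sym (ℤ.*-identityʳ (+ n))) (+≤+ m≤n))))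

  toℚ-+ : ∀ m n → toℚ (m ℕ.+ n) ≡ toℚ m + toℚ n
  toℚ-+ m n = ℚ.toℚᵘ-injective (ℚᵘ.≃-trans (ℚᵘ.≃-reflexive (toℚᵘ-toℚ (m ℕ.+ n)))
    (ℚᵘ.≃-trans integral (ℚᵘ.≃-sym (ℚᵘ.≃-trans (ℚ.toℚᵘ-homo-+ (toℚ m) (toℚ n))
      (ℚᵘ.≃-reflexive (cong₂ ℚᵘ._+_ (toℚᵘ-toℚ m) (toℚᵘ-toℚ n)))))))
    where
    integral : mkℚᵘ (+ (m ℕ.+ n)) 0 ℚᵘ.≃ (mkℚᵘ (+ m) 0 ℚᵘ.+ mkℚᵘ (+ n) 0)
    integral = *≡* (trans (ℤ.*-identityʳ (+ (m ℕ.+ n))) (trans (ℤ.pos-+ m n)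
      (sym (trans (ℤ.*-identityʳ _) (cong₂ ℤ._+_ (ℤ.*-identityʳ (+ m)) (ℤ.*-identityʳ (+ n)))))))

  toℚ-* : ∀ m n → toℚ (m ℕ.* n) ≡ toℚ m * toℚ n
  toℚ-* m n = ℚ.toℚᵘ-injective (ℚᵘ.≃-trans (ℚᵘ.≃-reflexive (toℚᵘ-toℚ (m ℕ.* n)))
    (ℚᵘ.≃-trans integral (ℚᵘ.≃-sym (ℚᵘ.≃-trans (ℚ.toℚᵘ-homo-* (toℚ m) (toℚ n))
      (ℚᵘ.≃-reflexive (cong₂ ℚᵘ._*_ (toℚᵘ-toℚ m) (toℚᵘ-toℚ n)))))))
    where
    integral : mkℚᵘ (+ (m ℕ.* n)) 0 ℚᵘ.≃ (mkℚᵘ (+ m) 0 ℚᵘ.* mkℚᵘ (+ n) 0)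
    integral = *≡* (trans (ℤ.*-identityʳ (+ (m ℕ.* n))) (trans (ℤ.pos-* m n) (sym (ℤ.*-identityʳ _))))

  0≤toℚ : ∀ n → 0ℚ ≤ toℚ n
  0≤toℚ n = toℚ-mono-≤ {0} {n} z≤n

  0≤* : ∀ {p q} → 0ℚ ≤ p → 0ℚ ≤ q → 0ℚ ≤ p * q
  0≤* {p} {q} 0≤p 0≤q = ℚ.nonNegative⁻¹ (p * q) {{ℚ.nonNeg*nonNeg⇒nonNeg p {{nonNegative 0≤p}} q {{nonNegative 0≤q}}}}

  0≤+ : ∀ {p q} → 0ℚ ≤ p → 0ℚ ≤ q → 0ℚ ≤ p + q
  0≤+ {p} {q} 0≤p 0≤q = ℚ.nonNegative⁻¹ (p + q) {{ℚ.nonNeg+nonNeg⇒nonNeg p {{nonNegative 0≤p}} q {{nonNegative 0≤q}}}}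

  0≤+/ : ∀ m n .{{_ : ℕ.NonZero n}} → 0ℚ ≤ + m / n
  0≤+/ m n = ℚ.nonNegative⁻¹ (+ m / n) {{ℚ.normalize-nonNeg m n}}

  ≤⇒0≤- : ∀ {p q} → p ≤ q → 0ℚ ≤ q - p
  ≤⇒0≤- {p} {q} p≤q = subst (_≤ q - p) (ℚ.+-inverseʳ p) (ℚ.+-monoˡ-≤ (- p) p≤q)

  0≤-⇒≤ : ∀ {p q} → 0ℚ ≤ q - p → p ≤ q
  0≤-⇒≤ {p} {q} 0≤q-p = subst₂ _≤_ (ℚ.+-identityˡ p) (cancel q p) (ℚ.+-monoˡ-≤ p 0≤q-p)
    where
    cancel : ∀ q p → q - p + p ≡ q
    cancel = solve 2 (λ q p → q :- p :+ p := q) refl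

  toℚ-∑-scaled : ∀ {n} (q : ℚ) (c v : Fin n → ℕ) → (∀ i → toℚ (c i) * q ≤ toℚ (v i)) → toℚ (sum c) * q ≤ toℚ (sum v)
  toℚ-∑-scaled {zero}  q c v _  = ℚ.≤-reflexive (ℚ.*-zeroˡ q)
  toℚ-∑-scaled {suc n} q c v cq≤v = begin
    toℚ (c zero ℕ.+ sum (λ i → c (suc i))) * q              ≡⟨ cong (_* q) (toℚ-+ (c zero) _) ⟩
    (toℚ (c zero) + toℚ (sum (λ i → c (suc i)))) * q        ≡⟨ ℚ.*-distribʳ-+ q (toℚ (c zero)) _ ⟩
    toℚ (c zero) * q + toℚ (sum (λ i → c (suc i))) * q
      ≤⟨ ℚ.+-mono-≤ (cq≤v zero) (toℚ-∑-scaled q (λ i → c (suc i)) (λ i → v (suc i)) (λ i → cq≤v (suc i))) ⟩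
    toℚ (v zero) + toℚ (sum (λ i → v (suc i)))              ≡⟨ toℚ-+ (v zero) _ ⟨
    toℚ (v zero ℕ.+ sum (λ i → v (suc i)))                  ∎
    where open ℚ.≤-Reasoning

  toℚ⟦⟧-scaled : ∀ c {q x} → (c ≡ true → q ≤ toℚ x) → toℚ ⟦ c ⟧ * q ≤ toℚ (⟦ c ⟧ ℕ.* x)
  toℚ⟦⟧-scaled false {q} _    = ℚ.≤-reflexive (ℚ.*-zeroˡ q)
  toℚ⟦⟧-scaled true  {q} {x} q≤x =
    subst₂ _≤_ (sym (ℚ.*-identityˡ q)) (cong toℚ (sym (ℕ.*-identityˡ x))) (q≤x refl)

  module ParameterBounds {ε λ′ : ℚ} (ε<½ : ε < ½) (0<λ : 0ℚ < λ′) (λ≤ε/4 : λ′ ≤ ε * (+ 1 / 4)) where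
    0≤ε : 0ℚ ≤ ε
    0≤ε = subst (0ℚ ≤_) (quadruple ε) (0≤* (ℚ.≤-trans (ℚ.<⇒≤ 0<λ) λ≤ε/4) (ℚ.≤ᵇ⇒≤ tt))
      where
      quadruple : ∀ ε → ε * (+ 1 / 4) * (+ 4 / 1) ≡ ε
      quadruple = solve 1 (λ ε → ε :* con (+ 1 / 4) :* con (+ 4 / 1) := ε) refl

    λ≤1 : λ′ ≤ 1ℚ
    λ≤1 = ℚ.≤-trans λ≤ε/4 (ℚ.≤-trans (ℚ.*-monoʳ-≤-nonNeg (+ 1 / 4) (ℚ.<⇒≤ ε<½)) (ℚ.≤ᵇ⇒≤ tt))

    1≤β : ∀ {β} → + 2 / 1 ≤ λ′ * β → 1ℚ ≤ β
    1≤β {β} 2≤λβ with ℚ.≤-total β 0ℚ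
    ... | inj₁ β≤0 = ⊥-elim (ℚ.<-irrefl refl (ℚ.<-≤-trans (ℚ.positive⁻¹ (+ 2 / 1)) (ℚ.≤-trans 2≤λβ λβ≤0)))
      where
      λβ≤0 : λ′ * β ≤ 0ℚ
      λβ≤0 = subst (λ′ * β ≤_) (ℚ.*-zeroʳ λ′) (ℚ.*-monoˡ-≤-nonNeg λ′ {{nonNegative (ℚ.<⇒≤ 0<λ)}} β≤0)
    ... | inj₂ 0≤β = ℚ.≤-trans (ℚ.≤ᵇ⇒≤ tt) (ℚ.≤-trans 2≤λβ
                       (subst (λ′ * β ≤_) (ℚ.*-identityˡ β) (ℚ.*-monoʳ-≤-nonNeg β {{nonNegative 0≤β}} λ≤1)))

    -- The certificate rests on (½ + ε)(2 - 4λ) ≥ 1, i.e. λ(1 + 2ε) ≤ ε, which holds with room to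
    -- spare since λ ≤ ε/4 and 1 + 2ε < 2.
    m≤[3/2+ε]n : ∀ {m n k s} → m ℕ.≤ k ℕ.+ s → k ℕ.≤ n → toℚ s * (+ 2 / 1 - + 4 / 1 * λ′) ≤ toℚ k →
                 toℚ m ≤ (+ 3 / 2 + ε) * toℚ n
    m≤[3/2+ε]n {m} {n} {k} {s} m≤k+s k≤n [2-4λ]s≤k = 0≤-⇒≤ (subst (0ℚ ≤_) (sym (certificate (toℚ m) (toℚ n) K S ε λ′))
      (0≤+ (0≤+ (0≤+ (0≤+ (0≤+
        (0≤* 0≤3/2+ε (≤⇒0≤- (toℚ-mono-≤ k≤n)))
        (≤⇒0≤- (subst (toℚ m ≤_) (toℚ-+ k s) (toℚ-mono-≤ m≤k+s))))
        (0≤* 0≤½+ε (≤⇒0≤- [2-4λ]s≤k)))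
        (0≤* (0≤* (0≤* (0≤+/ 2 1) (0≤toℚ s)) (≤⇒0≤- λ≤ε/4)) 0≤1+2ε))
        (0≤* (0≤* (0≤toℚ s) 0≤ε) (≤⇒0≤- (ℚ.<⇒≤ ε<½))))
        (0≤* (0≤toℚ s) 0≤ε)))
      where
      K = toℚ k
      S = toℚ s
      0≤3/2+ε : 0ℚ ≤ + 3 / 2 + ε
      0≤3/2+ε = 0≤+ (0≤+/ 3 2) 0≤ε
      0≤½+ε : 0ℚ ≤ ½ + ε
      0≤½+ε = 0≤+ (0≤+/ 1 2) 0≤ε
      0≤1+2ε : 0ℚ ≤ 1ℚ + + 2 / 1 * ε
      0≤1+2ε = 0≤+ (0≤+/ 1 1) (0≤* (0≤+/ 2 1) 0≤ε)
      certificate : ∀ M N K S ε λ′ →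
        (+ 3 / 2 + ε) * N - M ≡
        (+ 3 / 2 + ε) * (N - K) + (K + S - M) + (½ + ε) * (K - S * (+ 2 / 1 - + 4 / 1 * λ′))
          + + 2 / 1 * S * (ε * (+ 1 / 4) - λ′) * (1ℚ + + 2 / 1 * ε) + S * ε * (½ - ε) + S * ε
      certificate = solve 6 (λ M N K S ε λ′ →
        (con (+ 3 / 2) :+ ε) :* N :- M :=
        (con (+ 3 / 2) :+ ε) :* (N :- K) :+ (K :+ S :- M) :+ (con ½ :+ ε) :* (K :- S :* (con (+ 2 / 1) :- con (+ 4 / 1) :* λ′))
          :+ con (+ 2 / 1) :* S :* (ε :* con (+ 1 / 4) :- λ′) :* (con 1ℚ :+ con (+ 2 / 1) :* ε) :+ S :* ε :* (con ½ :- ε) :+ S :* ε) refl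

    [2-4λ]s≤k : ∀ {s k f B : ℕ} {β β⁻ : ℚ} → 1 ℕ.≤ B →
                4 ℕ.* f ℕ.≤ (2 ℕ.* s ℕ.+ k) ℕ.* B → toℚ s * β⁻ ≤ toℚ f → toℚ B ≤ β → (1ℚ - λ′) * β ≤ β⁻ →
                toℚ s * (+ 2 / 1 - + 4 / 1 * λ′) ≤ toℚ k
    [2-4λ]s≤k {s} {k} {f} {B} {β} {β⁻} 1≤B 4f≤[2s+k]B sβ⁻≤f B≤β [1-λ]β≤β⁻ =
      0≤-⇒≤ (ℚ.*-cancelˡ-≤-pos (toℚ B) {{positive 0<B}}
        (subst₂ _≤_ (sym (ℚ.*-zeroʳ (toℚ B))) (sym (certificate S K F (toℚ B) λ′ β β⁻))
        (0≤+ (0≤+ (0≤+ (≤⇒0≤- 4F≤[2S+K]B) (0≤* 0≤4 (≤⇒0≤- sβ⁻≤f)))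
                  (0≤* (0≤* 0≤4 (0≤toℚ s)) (≤⇒0≤- [1-λ]β≤β⁻)))
             (0≤* (0≤* (0≤* 0≤4 (0≤toℚ s)) (≤⇒0≤- λ≤1)) (≤⇒0≤- B≤β)))))
      where
      S = toℚ s
      K = toℚ k
      F = toℚ f
      0≤4 : 0ℚ ≤ + 4 / 1
      0≤4 = 0≤+/ 4 1
      0<B : 0ℚ < toℚ B
      0<B = ℚ.<-≤-trans (ℚ.positive⁻¹ 1ℚ) (toℚ-mono-≤ 1≤B)
      4F≤[2S+K]B : + 4 / 1 * F ≤ (+ 2 / 1 * S + K) * toℚ B
      4F≤[2S+K]B = subst₂ _≤_ (toℚ-* 4 f)
        (trans (toℚ-* (2 ℕ.* s ℕ.+ k) B) (cong (_* toℚ B) (trans (toℚ-+ (2 ℕ.* s) k) (cong (_+ K) (toℚ-* 2 s)))))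
        (toℚ-mono-≤ 4f≤[2s+k]B)
      certificate : ∀ S K F B l β β⁻ →
        B * (K - S * (+ 2 / 1 - + 4 / 1 * l)) ≡
        (+ 2 / 1 * S + K) * B - + 4 / 1 * F + + 4 / 1 * (F - S * β⁻) + + 4 / 1 * S * (β⁻ - (1ℚ - l) * β) + + 4 / 1 * S * (1ℚ - l) * (β - B)
      certificate = solve 7 (λ S K F B l β β⁻ →
        B :* (K :- S :* (con (+ 2 / 1) :- con (+ 4 / 1) :* l)) :=
        (con (+ 2 / 1) :* S :+ K) :* B :- con (+ 4 / 1) :* F :+ con (+ 4 / 1) :* (F :- S :* β⁻)
          :+ con (+ 4 / 1) :* S :* (β⁻ :- (con 1ℚ :- l) :* β) :+ con (+ 4 / 1) :* S :* (con 1ℚ :- l) :* (β :- B)) refl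

open import Data.Nat using (ℕ)
import Data.Nat as ℕ
open import Data.Nat.Properties using (+-*-semiring)
open import Algebra.Properties.Semiring.Sum +-*-semiring using (sum)
open import Data.Integer using (+_)
open import Data.Rational using (ℚ; _/_; _≤_; _<_; _+_; _*_; _-_; 0ℚ; 1ℚ; ½)
open FiniteSums using (⟦_⟧; maxᶠ-preserves)
open König using (VertexCover; vertexCover)
open DegreeCounting
  using (uncovered; uncovered-rows; uncovered-columns; uncovered-avoids; uncovered-matched;
         size≤cover+uncovered; uncovered-degree-bound; maxEdgeDegree; maxEdgeDegree-bound; 1≤maxEdgeDegree)
open RationalArithmetic

module _ {a b} {G H : BipGraph a b} {β β⁻ : ℚ} (edcs : IsEDCS G H β β⁻) where
  open IsEDCS edcs

  maxEdgeDegree≤β : 1ℚ ≤ β → toℚ (maxEdgeDegree H) ≤ β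
  maxEdgeDegree≤β 1≤β = maxᶠ-preserves (λ x → toℚ x ≤ β) 1 _ 1≤β λ l →
    maxᶠ-preserves (λ x → toℚ x ≤ β) 1 _ 1≤β (P1-bounded l)
    where
    P1-bounded : ∀ l r → toℚ (if H l r then degL H l ℕ.+ degR H r else 1) ≤ β
    P1-bounded l r with H l r in Hlr
    ... | true  = subst (_≤ β) (sym (toℚ-+ (degL H l) (degR H r))) (P1 l r (sub l r Hlr) Hlr)
    ... | false = 1≤β

  uncovered-degree≥β⁻ : ∀ {M} (M-matching : IsMatching G M) {coverL coverR} →
                        (∀ l r → H l r ≡ true → coverL l ≡ true ⊎ coverR r ≡ true) →
                        ∀ l r → uncovered M-matching coverL coverR l r ≡ true → β⁻ ≤ toℚ (degL H l ℕ.+ degR H r)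
  uncovered-degree≥β⁻ M-matching {coverL} {coverR} covers l r Ulr = subst (β⁻ ≤_) (sym (toℚ-+ (degL H l) (degR H r)))
    (P2 l r (IsMatching.edges M-matching l r (uncovered-matched M-matching coverL coverR l r Ulr)) Hlr≡false)
    where
    Hlr≡false : H l r ≡ false
    Hlr≡false with H l r in Hlr | uncovered-avoids M-matching coverL coverR l r Ulr
    ... | false | _ = refl
    ... | true  | cLl≡false , cRr≡false with covers l r Hlr
    ...   | inj₁ cLl = case trans (sym cLl) cLl≡false of λ ()
    ...   | inj₂ cRr = case trans (sym cRr) cRr≡false of λ ()

lemma3p1 : {a b : ℕ} (G : BipGraph a b) (ε λ′ β β⁻ : ℚ) →
    ε < ½ → 0ℚ < λ′ → λ′ ≤ ε * (+ 1 / 4) → + 2 / 1 ≤ λ′ * β → (1ℚ - λ′) * β ≤ β⁻ → β⁻ ≤ β →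
    (H : BipGraph a b) → IsEDCS G H β β⁻ →
    (M : Fin a → Maybe (Fin b)) → IsMaximumMatching G M →
    (N : Fin a → Maybe (Fin b)) → IsMaximumMatching H N →
    toℚ (size M) ≤ (+ 3 / 2 + ε) * toℚ (size N)
lemma3p1 {a} {b} G ε λ′ β β⁻ ε<½ 0<λ λ≤ε/4 2≤λβ [1-λ]β≤β⁻ _ H edcs M M-maximum N N-maximum =
  m≤[3/2+ε]n {k = k} {s} (size≤cover+uncovered M-matching coverL coverR) size≤
    ([2-4λ]s≤k {s} {k} {f} {B} (1≤maxEdgeDegree H) 4f≤[2s+k]B s·β⁻≤f
      (maxEdgeDegree≤β edcs (1≤β 2≤λβ)) [1-λ]β≤β⁻)
  where
  open ParameterBounds ε<½ 0<λ λ≤ε/4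

  M-matching : IsMatching G M
  M-matching = IsMaximumMatching.matching M-maximum

  open VertexCover (vertexCover N-maximum)

  U : Fin a → Fin b → Bool
  U = uncovered M-matching coverL coverR

  k s f B : ℕ
  k = count coverL ℕ.+ count coverR
  s = sum (λ l → sum (λ r → ⟦ U l r ⟧))
  f = sum (λ l → sum (λ r → ⟦ U l r ⟧ ℕ.* (degL H l ℕ.+ degR H r)))
  B = maxEdgeDegree H

  4f≤[2s+k]B : 4 ℕ.* f ℕ.≤ (2 ℕ.* s ℕ.+ k) ℕ.* B
  4f≤[2s+k]B = uncovered-degree-bound H coverL coverR covers (maxEdgeDegree-bound H) U
    (uncovered-rows M-matching coverL coverR) (uncovered-columns M-matching coverL coverR)
    (uncovered-avoids M-matching coverL coverR) (1≤maxEdgeDegree H)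

  s·β⁻≤f : toℚ s * β⁻ ≤ toℚ f
  s·β⁻≤f = toℚ-∑-scaled β⁻ _ _ λ l → toℚ-∑-scaled β⁻ _ _ λ r →
    toℚ⟦⟧-scaled (U l r) (uncovered-degree≥β⁻ edcs M-matching covers l r)
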